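{- For every positive integer $r$, the rooted disentangling number satisfies $$RD(r) = 3\left( \lfloor \log_{2}(r) \rfloor + 1\right).$$
   Context: For a finite set $X$, $\mathcal{RT}_X$ is the set of rooted binary leaf-labeled trees with leaf set $X$ (root of degree 2, other internal vertices of degree 3, leaves bijectively labeled by $X$, up to label-preserving isomorphism). For $K\subseteq X$ and $T\in\mathcal{RT}_X$, $T|_K\in\mathcal{RT}_K$ is the induced rooted binary tree on $K$: take the minimal subtree of $T$ spanning the leaves in $K$, root it at its vertex closest to the root of $T$, and suppress vertices of degree two. $\mathcal{RT}_{X,r}$ is the set of unordered lists (multisets, repetitions allowed) of length $r$ of elements of $\mathcal{RT}_X$; for $S=(T_1,\dots,T_r)$, $S|_K=(T_1|_K,\dots,T_r|_K)$. For $S_1\neq S_2\in\mathcal{RT}_{X,r}$, $d(S_1,S_2)$ is the minimum cardinality of a set $K\subseteq X$ with $S_1|_K\neq S_2|_K$. The rooted disentangling number is $RD(r)=\max_{n\in\mathbb{N}}\max_{S_1\neq S_2\in\mathcal{RT}_{[n],r}} d(S_1,S_2)$, where $[n]=\{1,\dots,n\}$. -}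

module Defs where

open import Data.Nat using (ℕ; _+_; _*_; _≤_; _<_)
open import Data.Nat.Logarithm using (⌊log₂_⌋)
open import Data.Fin using (Fin)
open import Data.Fin.Subset using (Subset; _∈_; ∣_∣)
open import Data.Fin.Subset.Properties using (_∈?_)
open import Data.List using (List; []; [_]; _++_; allFin)
open import Data.List.Relation.Binary.Permutation.Propositional using (_↭_)
open import Data.Maybe using (Maybe; just; nothing)
open import Data.Vec using (Vec; lookup; map)
open import Data.Product using (Σ; _×_; _,_)
open import Data.Sum using (_⊎_)
open import Function.Bundles using (_↔_; Inverse)
open import Relation.Nullary using (¬_; yes; no)

-- Rooted binary trees (as terms) with leaves labelled by Fin n.
-- A tree with at least 2 leaves: root has degree 2, internal vertices degree 3.
data Tree (n : ℕ) : Set where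
  leaf : Fin n → Tree n
  node : Tree n → Tree n → Tree n

leaves : ∀ {n} → Tree n → List (Fin n)
leaves (leaf x)   = [ x ]
leaves (node a b) = leaves a ++ leaves b

-- T ∈ RT_[n]: leaves are bijectively labelled by [n] = Fin n.
ValidTree : ∀ {n} → Tree n → Set
ValidTree {n} T = leaves T ↭ allFin n

-- Label-preserving isomorphism of rooted trees (children are unordered).
data _≅_ {n : ℕ} : Tree n → Tree n → Set where
  leaf≅ : ∀ x → leaf x ≅ leaf x
  node≅ : ∀ {a b c d} → a ≅ c → b ≅ d → node a b ≅ node c d
  swap≅ : ∀ {a b c d} → a ≅ d → b ≅ c → node a b ≅ node c d

-- Induced rooted binary tree T|_K (nothing iff K contains no leaf of T):
-- minimal spanning subtree, vertices of degree two suppressed.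
restrict : ∀ {n} → Subset n → Tree n → Maybe (Tree n)
restrict K (leaf x) with x ∈? K
... | yes _ = just (leaf x)
... | no  _ = nothing
restrict K (node a b) with restrict K a | restrict K b
... | just a′  | just b′  = just (node a′ b′)
... | just a′  | nothing  = just a′
... | nothing  | just b′  = just b′
... | nothing  | nothing  = nothing

data _≅ᴹ_ {n : ℕ} : Maybe (Tree n) → Maybe (Tree n) → Set where
  nothing≅ : nothing ≅ᴹ nothing
  just≅    : ∀ {a b} → a ≅ b → just a ≅ᴹ just b

-- Equality of unordered lists (multisets) of length r, modulo a relation R
-- on the entries: some bijection of positions matches entries up to R.
MultisetEq : ∀ {A : Set} {r : ℕ} → (A → A → Set) → Vec A r → Vec A r → Set
MultisetEq {r = r} R S₁ S₂ =
  Σ (Fin r ↔ Fin r) λ σ → ∀ i → R (lookup S₁ i) (lookup S₂ (Inverse.to σ i))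

ValidList : ∀ {n r} → Vec (Tree n) r → Set
ValidList {r = r} S = ∀ (i : Fin r) → ValidTree (lookup S i)

restrictList : ∀ {n r} → Subset n → Vec (Tree n) r → Vec (Maybe (Tree n)) r
restrictList K S = map (restrict K) S

Separates : ∀ {n r} → Subset n → Vec (Tree n) r → Vec (Tree n) r → Set
Separates K S₁ S₂ = ¬ MultisetEq _≅ᴹ_ (restrictList K S₁) (restrictList K S₂)

RD≤ : ℕ → ℕ → Set
RD≤ r b = ∀ (n : ℕ) (S₁ S₂ : Vec (Tree n) r) → ValidList S₁ → ValidList S₂ →
  ¬ MultisetEq _≅_ S₁ S₂ → Σ (Subset n) λ K → ∣ K ∣ ≤ b × Separates K S₁ S₂

RD≥ : ℕ → ℕ → Set
RD≥ r b = Σ ℕ λ n → Σ (Vec (Tree n) r) λ S₁ → Σ (Vec (Tree n) r) λ S₂ →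
  ValidList S₁ × ValidList S₂ × ¬ MultisetEq _≅_ S₁ S₂ ×
  (∀ (K : Subset n) → ∣ K ∣ < b →
     MultisetEq _≅ᴹ_ (restrictList K S₁) (restrictList K S₂))

RDis : ℕ → ℕ → Set
RDis r b = RD≤ r b × RD≥ r b

module Submission where

-- A tree with leaf set [n] is determined up to isomorphism by
-- the rooted triples ab|c it displays (`triples-determine`).  So if S₁ ≠ S₂,
-- some tree W has different multiplicities in S₁ and S₂ up to
-- triple-equivalence, since equal multiplicities yield a matching
-- (`matching`).  A halving argument (`slice`) then produces a "pattern" of at
-- most m triples with prescribed truth values, where r < 2^m, that is matched
-- by different numbers of trees of S₁ and of S₂.  Restriction to the ≤ 3m
-- leaves of the pattern preserves these triples (`displays-restrict`), so it
-- separates S₁ from S₂ (`upper-bound`).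
--
-- Lists P k, Q k of 2^k trees on 3 (k + 1) leaves are built
-- from A = ((0,1),2) and B = ((0,2),1) by adding three new leaves per level.
-- They differ, as one tree of P k and none of Q k displays 01|2 at every level
-- (`count-ψ`), but agree after deleting any leaf (`PQ-agree-without`); padding
-- gives every length r ≥ 2^k (`lower-bound`).

open import Defs
open import Data.Bool using (Bool; true; false; _∧_; _∨_; not)
open import Data.Bool.Properties using (∧-comm; ∧-zeroʳ; ∨-comm; ∨-identityʳ; ∨-zeroʳ; ∨-conicalˡ; ∨-conicalʳ; ∧-conicalˡ; ∧-conicalʳ; ¬-not; not-injective)
  renaming (_≟_ to _≟ᵇ_)
open import Data.Empty using (⊥; ⊥-elim)
open import Data.List using (List; []; _∷_; _++_; allFin; length)
import Data.List as List
import Data.List.Properties as List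
open import Data.List.Membership.Propositional using () renaming (_∈_ to _∈ˡ_)
open import Data.List.Membership.Propositional.Properties using (∈-++⁺ˡ; ∈-++⁺ʳ; ∈-++⁻; ∈-allFin)
import Data.List.Relation.Unary.All as All
import Data.List.Relation.Unary.All.Properties as All
open import Data.List.Relation.Unary.AllPairs using (_∷_; [])
open import Data.List.Relation.Unary.Any using (here; there)
open import Data.List.Relation.Unary.Unique.Propositional using (Unique)
open import Data.List.Relation.Unary.Unique.Propositional.Properties using (allFin⁺)
open import Data.List.Relation.Binary.Permutation.Propositional using (_↭_; ↭-refl; ↭-sym; prep; swap; ↭⇒↭ₛ)
open import Data.List.Relation.Binary.Permutation.Propositional.Properties using (∈-resp-↭) renaming (map⁺ to ↭-map⁺)
open import Data.List.Relation.Binary.Permutation.Setoid.Properties using (Unique-resp-↭)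
open import Data.Fin using (Fin; zero; suc; punchIn; splitAt; _↑ˡ_; _↑ʳ_)
open import Data.Fin.Properties using (all?; any?; ¬∀⟶∃¬; splitAt-↑ˡ; splitAt-↑ʳ; splitAt⁻¹-↑ˡ; splitAt⁻¹-↑ʳ) renaming (_≟_ to _≟ᶠ_)
open import Data.Fin.Subset using (Subset; _∈_; _∉_; ⁅_⁆; _∪_; ∣_∣) renaming (⊥ to ∅)
open import Data.Fin.Subset.Properties using (_∈?_; x∈⁅x⁆; p⊆p∪q; q⊆p∪q; ∣⁅x⁆∣≡1; ∣⊥∣≡0)
open import Data.Maybe using (Maybe; just; nothing)
open import Data.Vec using (Vec; []; _∷_; lookup; map; replicate; here; there) renaming (_++_ to _++ᵛ_)
open import Data.Vec.Properties using (lookup-map; lookup-++ˡ; lookup-++ʳ; map-++; lookup-replicate)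
open import Data.Vec.Relation.Unary.All using (_∷_; []) renaming (All to Allᵛ)
open import Data.Vec.Relation.Unary.All.Properties using (lookup⁺; lookup⁻; gmap) renaming (++⁺ to ++ᵛ⁺)
import Data.Fin.Permutation as Perm
open import Data.Nat using (ℕ; zero; suc; _+_; _*_; _∸_; _^_; _≤_; _<_; z≤n; s≤s; ⌊_/2⌋)
open import Data.Nat.Induction using (<-wellFounded)
open import Data.Nat.Logarithm using (⌊log₂_⌋)
open import Data.Nat.Logarithm.Core using (⌊log2⌋)
open import Induction.WellFounded using (Acc; acc)
open import Data.Nat.Properties
open import Data.Product using (Σ; _×_; _,_; proj₁; proj₂)
open import Data.Sum using (_⊎_; inj₁; inj₂; [_,_]′)
open import Function using (_∘_)
open import Function.Bundles using (_↔_; Inverse; mk↔ₛ′)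
open import Relation.Binary.PropositionalEquality
open import Relation.Nullary using (¬_; yes; no; Dec; does)
open import Relation.Nullary.Decidable using (dec-true; dec-false)

open import Algebra.Properties.CommutativeMonoid.Sum +-0-commutativeMonoid
  using (sum; sum-cong-≗; ∑-distrib-+; ∑-permute; sum-remove)

𝟙 : Bool → ℕ
𝟙 true  = 1
𝟙 false = 0

count : ∀ {A : Set} {r} → (A → Bool) → (Fin r → A) → ℕ
count P g = sum (λ i → 𝟙 (P (g i)))

count-ext : ∀ {A B : Set} {r} (P : A → Bool) (g : Fin r → A) (P′ : B → Bool) (g′ : Fin r → B) →
  (∀ i → P (g i) ≡ P′ (g′ i)) → count P g ≡ count P′ g′
count-ext P g P′ g′ h = sum-cong-≗ (λ i → cong 𝟙 (h i))

count-congˡ : ∀ {A : Set} {r} {P P′ : A → Bool} (g : Fin r → A) →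
  (∀ x → P x ≡ P′ x) → count P g ≡ count P′ g
count-congˡ {P = P} {P′} g h = count-ext P g P′ g (h ∘ g)

count-const-true : ∀ {A : Set} {r} (g : Fin r → A) → count (λ _ → true) g ≡ r
count-const-true {r = zero}  g = refl
count-const-true {r = suc r} g = cong suc (count-const-true (g ∘ suc))

count-const-false : ∀ {A : Set} {r} (P : A → Bool) (g : Fin r → A) →
  (∀ x → P x ≡ false) → count P g ≡ 0
count-const-false {r = zero}  P g h = refl
count-const-false {r = suc r} P g h rewrite h (g zero) = count-const-false P (g ∘ suc) h

count-split : ∀ {A : Set} {r} (H P : A → Bool) (g : Fin r → A) →
  count (λ x → H x ∧ P x) g + count (λ x → not (H x) ∧ P x) g ≡ count P g
count-split H P g =
  trans (sym (∑-distrib-+ (λ i → 𝟙 (H (g i) ∧ P (g i))) (λ i → 𝟙 (not (H (g i)) ∧ P (g i)))))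
    (sum-cong-≗ (λ i → 𝟙-split (H (g i)) (P (g i))))
  where
  𝟙-split : ∀ a b → 𝟙 (a ∧ b) + 𝟙 (not a ∧ b) ≡ 𝟙 b
  𝟙-split true  b = +-identityʳ (𝟙 b)
  𝟙-split false b = refl

count-remove : ∀ {A : Set} {r} (P : A → Bool) (g : Fin (suc r) → A) (j : Fin (suc r)) →
  count P g ≡ 𝟙 (P (g j)) + count P (g ∘ punchIn j)
count-remove P g j = sum-remove {i = j} (λ i → 𝟙 (P (g i)))

count-witness : ∀ {A : Set} {r} (P : A → Bool) (g : Fin r → A) →
  1 ≤ count P g → Σ (Fin r) λ j → P (g j) ≡ true
count-witness {r = zero}  P g ()
count-witness {r = suc r} P g h with P (g zero) in e
... | true  = zero , e
... | false = let (j , e′) = count-witness P (g ∘ suc) h in suc j , e′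

count-permute : ∀ {A : Set} {r} (P : A → Bool) (g g′ : Fin r → A) (σ : Fin r ↔ Fin r) →
  (∀ i → P (g i) ≡ P (g′ (Inverse.to σ i))) → count P g ≡ count P g′
count-permute P g g′ σ h =
  trans (count-ext P g P (g′ ∘ Inverse.to σ) h) (sym (∑-permute (λ i → 𝟙 (P (g′ i))) σ))

does-true : ∀ {P : Set} (d : Dec P) → does d ≡ true → P
does-true (yes p) _ = p

true≢false : true ≢ false
true≢false ()

∨-introˡ : ∀ {x} y → x ≡ true → x ∨ y ≡ true
∨-introˡ y refl = refl

∨-introʳ : ∀ x {y} → y ≡ true → x ∨ y ≡ true
∨-introʳ x refl = ∨-zeroʳ x

∨-elim : ∀ {x y} → x ∨ y ≡ true → x ≡ true ⊎ y ≡ true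
∨-elim {true}  _ = inj₁ refl
∨-elim {false} h = inj₂ h

∨-resolve : ∀ {x y} → x ∨ y ≡ true → x ≡ false → y ≡ true
∨-resolve h refl = h

bool-ext : ∀ {x y : Bool} → (x ≡ true → y ≡ true) → (y ≡ true → x ≡ true) → x ≡ y
bool-ext {true}  {true}  f g = refl
bool-ext {false} {false} f g = refl
bool-ext {true}  {false} f g = sym (f refl)
bool-ext {false} {true}  f g = g refl

module Multiplicity {A : Set} (_≈ᵇ_ : A → A → Bool)
  (≈ᵇ-refl  : ∀ x → x ≈ᵇ x ≡ true)
  (≈ᵇ-sym   : ∀ x y → x ≈ᵇ y ≡ true → y ≈ᵇ x ≡ true)
  (≈ᵇ-trans : ∀ x y z → x ≈ᵇ y ≡ true → y ≈ᵇ z ≡ true → x ≈ᵇ z ≡ true) where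

  mult : ∀ {r} → A → (Fin r → A) → ℕ
  mult u g = count (u ≈ᵇ_) g

  ≈ᵇ-congʳ : ∀ u {x y} → x ≈ᵇ y ≡ true → u ≈ᵇ x ≡ u ≈ᵇ y
  ≈ᵇ-congʳ u {x} {y} h with u ≈ᵇ x in e₁ | u ≈ᵇ y in e₂
  ... | true  | true  = refl
  ... | false | false = refl
  ... | true  | false = trans (sym (≈ᵇ-trans u x y e₁ h)) e₂
  ... | false | true  = trans (sym e₁) (≈ᵇ-trans u y x e₂ (≈ᵇ-sym x y h))

  mult-self : ∀ {r} (f : Fin (suc r) → A) → 1 ≤ mult (f zero) f
  mult-self f rewrite ≈ᵇ-refl (f zero) = s≤s z≤n

  module Peel {r s} (f : Fin (suc r) → A) (g : Fin (suc s) → A) (j : Fin (suc s))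
    (e : f zero ≈ᵇ g j ≡ true) (u : A) where

    peelˡ : mult u f ≡ 𝟙 (u ≈ᵇ g j) + mult u (f ∘ suc)
    peelˡ = cong (λ b → 𝟙 b + mult u (f ∘ suc)) (≈ᵇ-congʳ u e)

    peel-≤ : mult u f ≤ mult u g → mult u (f ∘ suc) ≤ mult u (g ∘ punchIn j)
    peel-≤ h = +-cancelˡ-≤ (𝟙 (u ≈ᵇ g j)) _ _ (subst₂ _≤_ peelˡ (count-remove (u ≈ᵇ_) g j) h)

    peel-≡ : mult u f ≡ mult u g → mult u (f ∘ suc) ≡ mult u (g ∘ punchIn j)
    peel-≡ h = +-cancelˡ-≡ (𝟙 (u ≈ᵇ g j)) _ _ (trans (sym peelˡ) (trans h (count-remove (u ≈ᵇ_) g j)))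

  partner : ∀ {r s} (f : Fin (suc r) → A) (g : Fin s → A) →
    mult (f zero) f ≤ mult (f zero) g → Σ (Fin s) λ j → f zero ≈ᵇ g j ≡ true
  partner f g h = count-witness (f zero ≈ᵇ_) g (≤-trans (mult-self f) h)

  -- Induction on f:
  -- a Q-entry f zero is matched with a partner g j and both are removed.
  count-≤ : ∀ {r s} (Q : A → Bool) → (∀ x y → x ≈ᵇ y ≡ true → Q x ≡ Q y) →
    (f : Fin r → A) (g : Fin s → A) →
    (∀ i → Q (f i) ≡ true → mult (f i) f ≤ mult (f i) g) → count Q f ≤ count Q g
  count-≤-matched : ∀ {r s} (Q : A → Bool) → (∀ x y → x ≈ᵇ y ≡ true → Q x ≡ Q y) →
    (f : Fin (suc r) → A) (g : Fin s → A) →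
    (∀ i → Q (f i) ≡ true → mult (f i) f ≤ mult (f i) g) → Q (f zero) ≡ true →
    (j : Fin s) → f zero ≈ᵇ g j ≡ true → count Q f ≤ count Q g

  count-≤ {zero}  Q Q-resp f g h = z≤n
  count-≤ {suc r} Q Q-resp f g h with Q (f zero) in q₀
  ... | false = count-≤ Q Q-resp (f ∘ suc) g
        (λ i q → ≤-trans (m≤n+m _ (𝟙 (f (suc i) ≈ᵇ f zero))) (h (suc i) q))
  ... | true  = subst (λ b → 𝟙 b + count Q (f ∘ suc) ≤ count Q g) q₀
        (count-≤-matched Q Q-resp f g h q₀ (proj₁ j,e) (proj₂ j,e))
    where j,e = partner f g (h zero q₀)

  count-≤-matched {s = suc s} Q Q-resp f g h q₀ j e = begin
    𝟙 (Q (f zero)) + count Q (f ∘ suc)       ≤⟨ +-monoʳ-≤ _ (count-≤ Q Q-resp (f ∘ suc) (g ∘ punchIn j) rest) ⟩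
    𝟙 (Q (f zero)) + count Q (g ∘ punchIn j) ≡⟨ cong (λ b → 𝟙 b + count Q (g ∘ punchIn j)) (Q-resp _ _ e) ⟩
    𝟙 (Q (g j)) + count Q (g ∘ punchIn j)    ≡⟨ sym (count-remove Q g j) ⟩
    count Q g                                ∎
    where
    open ≤-Reasoning
    rest : ∀ i → Q (f (suc i)) ≡ true → mult (f (suc i)) (f ∘ suc) ≤ mult (f (suc i)) (g ∘ punchIn j)
    rest i q = Peel.peel-≤ f g j e (f (suc i)) (h (suc i) q)

  matching : ∀ {r} (f g : Fin r → A) → (∀ i → mult (f i) f ≡ mult (f i) g) →
    Σ (Fin r ↔ Fin r) λ σ → ∀ i → f i ≈ᵇ g (Inverse.to σ i) ≡ true
  matching {zero}  f g h = Perm.id , λ ()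
  matching {suc r} f g h = Perm.insert zero j σ , matched
    where
    j = proj₁ (partner f g (≤-reflexive (h zero)))
    e = proj₂ (partner f g (≤-reflexive (h zero)))
    rest = matching (f ∘ suc) (g ∘ punchIn j) (λ i → Peel.peel-≡ f g j e (f (suc i)) (h (suc i)))
    σ = proj₁ rest
    matched : ∀ i → f i ≈ᵇ g (Inverse.to (Perm.insert zero j σ) i) ≡ true
    matched zero    = e
    matched (suc i) = subst (λ k → f (suc i) ≈ᵇ g k ≡ true)
                        (sym (Perm.insert-punchIn zero j σ i)) (proj₂ rest i)

module _ {A : Set} (R : A → A → Set) where

  multiset-pointwise : ∀ {r} (xs ys : Vec A r) → (∀ i → R (lookup xs i) (lookup ys i)) → MultisetEq R xs ys
  multiset-pointwise xs ys h = Perm.id , h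

  multiset-sym : ∀ {r} → (∀ {a b} → R a b → R b a) → (xs ys : Vec A r) → MultisetEq R xs ys → MultisetEq R ys xs
  multiset-sym R-sym xs ys (σ , h) =
    Perm.flip σ , λ i → R-sym (subst (R (lookup xs (Inverse.from σ i)) ∘ lookup ys) (Perm.inverseʳ σ) (h (Inverse.from σ i)))

  _⊕ᵖ_ : ∀ {m n} → Fin m ↔ Fin m → Fin n ↔ Fin n → Fin (m + n) ↔ Fin (m + n)
  _⊕ᵖ_ {m} {n} σ τ = mk↔ₛ′ (along Inverse.to Inverse.to) (along Inverse.from Inverse.from)
                          (cancel Inverse.to Inverse.from (Perm.inverseʳ σ) (Perm.inverseʳ τ))
                          (cancel Inverse.from Inverse.to (Perm.inverseˡ σ) (Perm.inverseˡ τ))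
    where
    along : (Fin m ↔ Fin m → Fin m → Fin m) → (Fin n ↔ Fin n → Fin n → Fin n) → Fin (m + n) → Fin (m + n)
    along s t i = [ (λ a → s σ a ↑ˡ n) , (λ b → m ↑ʳ t τ b) ]′ (splitAt m i)
    cancel : ∀ (s s′ : ∀ {k} → Fin k ↔ Fin k → Fin k → Fin k) →
      (∀ {a} → s σ (s′ σ a) ≡ a) → (∀ {b} → s τ (s′ τ b) ≡ b) → ∀ i → along s s (along s′ s′ i) ≡ i
    cancel s s′ σσ ττ i with splitAt m i in e
    ... | inj₁ a rewrite splitAt-↑ˡ m (s′ σ a) n = trans (cong (_↑ˡ n) σσ) (splitAt⁻¹-↑ˡ e)
    ... | inj₂ b rewrite splitAt-↑ʳ m n (s′ τ b) = trans (cong (m ↑ʳ_) ττ) (splitAt⁻¹-↑ʳ e)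

  multiset-++ : ∀ {m n} (xs xs′ : Vec A m) (ys ys′ : Vec A n) → MultisetEq R xs xs′ → MultisetEq R ys ys′ →
    MultisetEq R (xs ++ᵛ ys) (xs′ ++ᵛ ys′)
  multiset-++ {m} xs xs′ ys ys′ (σ , h₁) (τ , h₂) = σ ⊕ᵖ τ , pointwise
    where
    pointwise : ∀ i → R (lookup (xs ++ᵛ ys) i) (lookup (xs′ ++ᵛ ys′) (Inverse.to (σ ⊕ᵖ τ) i))
    pointwise i with splitAt m i in e
    ... | inj₁ a rewrite sym (splitAt⁻¹-↑ˡ e) | lookup-++ˡ xs ys a | lookup-++ˡ xs′ ys′ (Inverse.to σ a) = h₁ a
    ... | inj₂ b rewrite sym (splitAt⁻¹-↑ʳ e) | lookup-++ʳ xs ys b | lookup-++ʳ xs′ ys′ (Inverse.to τ b) = h₂ b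

  swapᵖ : ∀ m → Fin (m + m) ↔ Fin (m + m)
  swapᵖ m = mk↔ₛ′ exchange exchange involutive involutive
    where
    exchange : Fin (m + m) → Fin (m + m)
    exchange i = [ (λ a → m ↑ʳ a) , (λ b → b ↑ˡ m) ]′ (splitAt m i)
    involutive : ∀ i → exchange (exchange i) ≡ i
    involutive i with splitAt m i in e
    ... | inj₁ a rewrite splitAt-↑ʳ m m a = splitAt⁻¹-↑ˡ e
    ... | inj₂ b rewrite splitAt-↑ˡ m b m = splitAt⁻¹-↑ʳ e

  multiset-++-swap : ∀ {m} (xs xs′ ys ys′ : Vec A m) → (∀ i → R (lookup xs i) (lookup xs′ i)) →
    (∀ i → R (lookup ys i) (lookup ys′ i)) → MultisetEq R (xs ++ᵛ ys) (ys′ ++ᵛ xs′)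
  multiset-++-swap {m} xs xs′ ys ys′ h₁ h₂ = swapᵖ m , pointwise
    where
    pointwise : ∀ i → R (lookup (xs ++ᵛ ys) i) (lookup (ys′ ++ᵛ xs′) (Inverse.to (swapᵖ m) i))
    pointwise i with splitAt m i in e
    ... | inj₁ a rewrite sym (splitAt⁻¹-↑ˡ e) | lookup-++ˡ xs ys a | lookup-++ʳ ys′ xs′ a = h₁ a
    ... | inj₂ b rewrite sym (splitAt⁻¹-↑ʳ e) | lookup-++ʳ xs ys b | lookup-++ˡ ys′ xs′ b = h₂ b

multiset-map : ∀ {A B : Set} (R : A → A → Set) (R′ : B → B → Set) {r} (h : A → B) →
  (∀ {a b} → R a b → R′ (h a) (h b)) → (xs ys : Vec A r) → MultisetEq R xs ys → MultisetEq R′ (map h xs) (map h ys)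
multiset-map R R′ h h-resp xs ys (σ , e) =
  σ , λ i → subst₂ R′ (sym (lookup-map i h xs)) (sym (lookup-map (Inverse.to σ i) h ys)) (h-resp (e i))

halving : ∀ {a b} m → a + b < 2 ^ suc m → a < 2 ^ m ⊎ b < 2 ^ m
halving {a} {b} m lt with a <? 2 ^ m | b <? 2 ^ m
... | yes a< | _     = inj₁ a<
... | no  _  | yes b< = inj₂ b<
... | no  a≮ | no  b≮ = ⊥-elim (<⇒≱ lt (begin
      2 ^ suc m       ≡⟨ cong (2 ^ m +_) (+-identityʳ (2 ^ m)) ⟩
      2 ^ m + 2 ^ m   ≤⟨ +-mono-≤ (≮⇒≥ a≮) (≮⇒≥ b≮) ⟩
      a + b           ∎))
  where open ≤-Reasoning

∣p∪q∣≤∣p∣+∣q∣ : ∀ {n} (p q : Subset n) → ∣ p ∪ q ∣ ≤ ∣ p ∣ + ∣ q ∣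
∣p∪q∣≤∣p∣+∣q∣ []          []          = z≤n
∣p∪q∣≤∣p∣+∣q∣ (true ∷ p)  (true ∷ q)  = s≤s (≤-trans (∣p∪q∣≤∣p∣+∣q∣ p q) (+-monoʳ-≤ ∣ p ∣ (n≤1+n _)))
∣p∪q∣≤∣p∣+∣q∣ (true ∷ p)  (false ∷ q) = s≤s (∣p∪q∣≤∣p∣+∣q∣ p q)
∣p∪q∣≤∣p∣+∣q∣ (false ∷ p) (true ∷ q)  = ≤-trans (s≤s (∣p∪q∣≤∣p∣+∣q∣ p q)) (≤-reflexive (sym (+-suc ∣ p ∣ ∣ q ∣)))
∣p∪q∣≤∣p∣+∣q∣ (false ∷ p) (false ∷ q) = ∣p∪q∣≤∣p∣+∣q∣ p q

missing-element : ∀ {n} (K : Subset n) → ∣ K ∣ < n → Σ (Fin n) λ x → x ∉ K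
missing-element (false ∷ K) _ = zero , λ ()
missing-element (true ∷ K) (s≤s small) =
  let (x , x∉) = missing-element K small in suc x , λ { (there x∈) → x∉ x∈ }

halves : ∀ m → ⌊ m /2⌋ + ⌊ m /2⌋ ≤ m × m ≤ suc (⌊ m /2⌋ + ⌊ m /2⌋)
halves zero          = z≤n , z≤n
halves (suc zero)    = z≤n , s≤s z≤n
halves (suc (suc m)) =
  let (lo , hi) = halves m ; h = ⌊ m /2⌋ in
  ≤-trans (≤-reflexive (cong suc (+-suc h h))) (s≤s (s≤s lo)) ,
  ≤-trans (s≤s (s≤s hi)) (≤-reflexive (cong suc (cong suc (sym (+-suc h h)))))

double-suc : ∀ h → 2 * suc h ≡ suc (suc (h + h))
double-suc h = trans (cong (suc h +_) (+-identityʳ (suc h))) (cong suc (+-suc h h))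

log₂-bounds : ∀ r → 1 ≤ r → 2 ^ ⌊log₂ r ⌋ ≤ r × r < 2 ^ suc ⌊log₂ r ⌋
log₂-bounds r = bounds r (<-wellFounded r)
  where
  bounds : ∀ n (a : Acc _<_ n) → 1 ≤ n → 2 ^ ⌊log2⌋ n a ≤ n × n < 2 ^ suc (⌊log2⌋ n a)
  bounds (suc zero)    _        _ = s≤s z≤n , s≤s (s≤s z≤n)
  bounds (suc (suc m)) (acc rs) _ = lower , upper
    where
    h = ⌊ m /2⌋
    l = ⌊log2⌋ (suc h) (rs (⌊n/2⌋<n (suc m)))
    IH = bounds (suc h) (rs (⌊n/2⌋<n (suc m))) (s≤s z≤n)
    lower : 2 ^ suc l ≤ suc (suc m)
    lower = begin
      2 * 2 ^ l         ≤⟨ *-monoʳ-≤ 2 (proj₁ IH) ⟩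
      2 * suc h         ≡⟨ double-suc h ⟩
      suc (suc (h + h)) ≤⟨ s≤s (s≤s (proj₁ (halves m))) ⟩
      suc (suc m)       ∎
      where open ≤-Reasoning
    upper : suc (suc m) < 2 ^ suc (suc l)
    upper = begin-strict
      suc (suc m)                   ≤⟨ s≤s (s≤s (proj₂ (halves m))) ⟩
      suc (suc (suc (h + h)))       <⟨ n<1+n _ ⟩
      suc (suc (suc (suc (h + h)))) ≡⟨ sym (trans (double-suc (suc h)) (cong (λ z → suc (suc (suc z))) (+-suc h h))) ⟩
      2 * suc (suc h)               ≤⟨ *-monoʳ-≤ 2 (proj₂ IH) ⟩
      2 * 2 ^ suc l                 ∎
      where open ≤-Reasoning

-- Triples (a , b , c) of leaves, read as the rooted triple ab|c.
Triple : ℕ → Set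
Triple n = Fin n × Fin n × Fin n

occurs : ∀ {n} → Fin n → Tree n → Bool
occurs x (leaf y)   = does (x ≟ᶠ y)
occurs x (node L R) = occurs x L ∨ occurs x R

clusterHas : ∀ {n} → Triple n → Tree n → Bool
clusterHas (a , b , c) T = occurs a T ∧ (occurs b T ∧ not (occurs c T))

displays : ∀ {n} → Triple n → Tree n → Bool
displays t (leaf y)   = clusterHas t (leaf y)
displays t (node L R) = clusterHas t (node L R) ∨ (displays t L ∨ displays t R)

clusterHas-cong : ∀ {n} a b c (T U : Tree n) → occurs a T ≡ occurs a U → occurs b T ≡ occurs b U →
  occurs c T ≡ occurs c U → clusterHas (a , b , c) T ≡ clusterHas (a , b , c) U
clusterHas-cong a b c T U ea eb ec rewrite ea | eb | ec = refl

clusterHas-yes : ∀ {n} a b c (T : Tree n) → occurs a T ≡ true → occurs b T ≡ true →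
  occurs c T ≡ false → clusterHas (a , b , c) T ≡ true
clusterHas-yes a b c T ha hb hc rewrite ha | hb | hc = refl

clusterHas-noᵃ : ∀ {n} a b c (T : Tree n) → occurs a T ≡ false → clusterHas (a , b , c) T ≡ false
clusterHas-noᵃ a b c T h rewrite h = refl

clusterHas-noᵇ : ∀ {n} a b c (T : Tree n) → occurs b T ≡ false → clusterHas (a , b , c) T ≡ false
clusterHas-noᵇ a b c T h rewrite h = ∧-zeroʳ (occurs a T)

clusterHas-noᶜ : ∀ {n} a b c (T : Tree n) → occurs c T ≡ true → clusterHas (a , b , c) T ≡ false
clusterHas-noᶜ a b c T h rewrite h = trans (cong (occurs a T ∧_) (∧-zeroʳ (occurs b T))) (∧-zeroʳ (occurs a T))

displays-root : ∀ {n} (t : Triple n) T → clusterHas t T ≡ true → displays t T ≡ true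
displays-root t (leaf y)   h = h
displays-root t (node L R) h rewrite h = refl

displays-noᵃ : ∀ {n} a b c (T : Tree n) → occurs a T ≡ false → displays (a , b , c) T ≡ false
displays-noᵃ a b c (leaf y) h = clusterHas-noᵃ a b c (leaf y) h
displays-noᵃ a b c (node L R) h
  rewrite clusterHas-noᵃ a b c (node L R) h
        | displays-noᵃ a b c L (∨-conicalˡ (occurs a L) _ h)
        | displays-noᵃ a b c R (∨-conicalʳ (occurs a L) _ h) = refl

displays-noᵇ : ∀ {n} a b c (T : Tree n) → occurs b T ≡ false → displays (a , b , c) T ≡ false
displays-noᵇ a b c (leaf y) h = clusterHas-noᵇ a b c (leaf y) h
displays-noᵇ a b c (node L R) h
  rewrite clusterHas-noᵇ a b c (node L R) h
        | displays-noᵇ a b c L (∨-conicalˡ (occurs b L) _ h)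
        | displays-noᵇ a b c R (∨-conicalʳ (occurs b L) _ h) = refl

displays-nodeˡ : ∀ {n} a b c (L R : Tree n) → occurs a R ≡ false → occurs b R ≡ false →
  occurs c R ≡ false → displays (a , b , c) (node L R) ≡ displays (a , b , c) L
displays-nodeˡ a b c L R ha hb hc
  rewrite ha | hb | hc | displays-noᵃ a b c R ha
        | ∨-identityʳ (occurs a L) | ∨-identityʳ (occurs b L) | ∨-identityʳ (occurs c L)
  with clusterHas (a , b , c) L in e
... | false = ∨-identityʳ (displays (a , b , c) L)
... | true  = sym (displays-root (a , b , c) L e)

displays-nodeʳ : ∀ {n} a b c (L R : Tree n) → occurs a L ≡ false → occurs b L ≡ false →
  occurs c L ≡ false → displays (a , b , c) (node L R) ≡ displays (a , b , c) R
displays-nodeʳ a b c L R ha hb hc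
  rewrite ha | hb | hc | displays-noᵃ a b c L ha
  with clusterHas (a , b , c) R in e
... | false = refl
... | true  = sym (displays-root (a , b , c) R e)

≅-refl : ∀ {n} (T : Tree n) → T ≅ T
≅-refl (leaf x)   = leaf≅ x
≅-refl (node a b) = node≅ (≅-refl a) (≅-refl b)

≅-sym : ∀ {n} {T U : Tree n} → T ≅ U → U ≅ T
≅-sym (leaf≅ x)   = leaf≅ x
≅-sym (node≅ p q) = node≅ (≅-sym p) (≅-sym q)
≅-sym (swap≅ p q) = swap≅ (≅-sym q) (≅-sym p)

occurs-≅ : ∀ {n} x {T U : Tree n} → T ≅ U → occurs x T ≡ occurs x U
occurs-≅ x (leaf≅ y)   = refl
occurs-≅ x (node≅ p q) = cong₂ _∨_ (occurs-≅ x p) (occurs-≅ x q)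
occurs-≅ x (swap≅ {c = c} {d} p q) =
  trans (cong₂ _∨_ (occurs-≅ x p) (occurs-≅ x q)) (∨-comm (occurs x d) (occurs x c))

displays-≅ : ∀ {n} (t : Triple n) {T U : Tree n} → T ≅ U → displays t T ≡ displays t U
displays-≅ t (leaf≅ y) = refl
displays-≅ t@(a , b , c) T≅U@(node≅ {T₁} {T₂} {U₁} {U₂} p q) =
  cong₂ _∨_ (clusterHas-cong a b c (node T₁ T₂) (node U₁ U₂) (occurs-≅ a T≅U) (occurs-≅ b T≅U) (occurs-≅ c T≅U))
            (cong₂ _∨_ (displays-≅ t p) (displays-≅ t q))
displays-≅ t@(a , b , c) T≅U@(swap≅ {T₁} {T₂} {U₁} {U₂} p q) =
  cong₂ _∨_ (clusterHas-cong a b c (node T₁ T₂) (node U₁ U₂) (occurs-≅ a T≅U) (occurs-≅ b T≅U) (occurs-≅ c T≅U))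
            (trans (cong₂ _∨_ (displays-≅ t p) (displays-≅ t q)) (∨-comm (displays t U₂) (displays t U₁)))

joinᴹ : ∀ {n} → Maybe (Tree n) → Maybe (Tree n) → Maybe (Tree n)
joinᴹ (just a) (just b) = just (node a b)
joinᴹ (just a) nothing  = just a
joinᴹ nothing  (just b) = just b
joinᴹ nothing  nothing  = nothing

restrict-node : ∀ {n} (K : Subset n) a b → restrict K (node a b) ≡ joinᴹ (restrict K a) (restrict K b)
restrict-node K a b with restrict K a | restrict K b
... | just _  | just _  = refl
... | just _  | nothing = refl
... | nothing | just _  = refl
... | nothing | nothing = refl

occursᴹ : ∀ {n} → Fin n → Maybe (Tree n) → Bool
occursᴹ x nothing  = false
occursᴹ x (just T) = occurs x T

displaysᴹ : ∀ {n} → Triple n → Maybe (Tree n) → Bool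
displaysᴹ t nothing  = false
displaysᴹ t (just T) = displays t T

occurs-restrict : ∀ {n} (K : Subset n) T x → x ∈ K → occursᴹ x (restrict K T) ≡ occurs x T
occurs-restrict K (leaf y) x x∈K with y ∈? K
... | yes _   = refl
... | no  y∉K = sym (dec-false (x ≟ᶠ y) (λ { refl → y∉K x∈K }))
occurs-restrict K (node L R) x x∈K rewrite restrict-node K L R
  with restrict K L | restrict K R | occurs-restrict K L x x∈K | occurs-restrict K R x x∈K
... | just L′ | just R′ | eL | eR = cong₂ _∨_ eL eR
... | just L′ | nothing | eL | eR rewrite eL | sym eR = sym (∨-identityʳ (occurs x L))
... | nothing | just R′ | eL | eR rewrite eR | sym eL = refl
... | nothing | nothing | eL | eR rewrite sym eL | sym eR = refl

displays-restrict : ∀ {n} (K : Subset n) {a b c} → a ∈ K → b ∈ K → c ∈ K →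
  ∀ T → displaysᴹ (a , b , c) (restrict K T) ≡ displays (a , b , c) T
displays-restrict K {a} {b} {c} a∈K b∈K c∈K (leaf y) with y ∈? K
... | yes _   = refl
... | no  y∉K = sym (clusterHas-noᵃ a b c (leaf y) (dec-false (a ≟ᶠ y) (λ { refl → y∉K a∈K })))
displays-restrict K {a} {b} {c} a∈K b∈K c∈K (node L R) rewrite restrict-node K L R
  with restrict K L | restrict K R
     | displays-restrict K a∈K b∈K c∈K L | displays-restrict K a∈K b∈K c∈K R
     | occurs-restrict K L | occurs-restrict K R
... | just L′ | just R′ | eL | eR | oL | oR =
  cong₂ _∨_ (clusterHas-cong a b c (node L′ R′) (node L R)
               (cong₂ _∨_ (oL a a∈K) (oR a a∈K)) (cong₂ _∨_ (oL b b∈K) (oR b b∈K)) (cong₂ _∨_ (oL c c∈K) (oR c c∈K)))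
            (cong₂ _∨_ eL eR)
... | just L′ | nothing | eL | eR | oL | oR =
  trans eL (sym (displays-nodeˡ a b c L R (sym (oR a a∈K)) (sym (oR b b∈K)) (sym (oR c c∈K))))
... | nothing | just R′ | eL | eR | oL | oR =
  trans eR (sym (displays-nodeʳ a b c L R (sym (oL a a∈K)) (sym (oL b b∈K)) (sym (oL c c∈K))))
... | nothing | nothing | eL | eR | oL | oR =
  sym (displays-noᵃ a b c (node L R) (cong₂ _∨_ (sym (oL a a∈K)) (sym (oR a a∈K))))

occurs-refl : ∀ {n} (x : Fin n) → occurs x (leaf x) ≡ true
occurs-refl x = dec-true (x ≟ᶠ x) refl

occurs⇒∈ : ∀ {n} x (T : Tree n) → occurs x T ≡ true → x ∈ˡ leaves T
occurs⇒∈ x (leaf y) h = here (does-true (x ≟ᶠ y) h)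
occurs⇒∈ x (node L R) h with ∨-elim {occurs x L} h
... | inj₁ e = ∈-++⁺ˡ (occurs⇒∈ x L e)
... | inj₂ e = ∈-++⁺ʳ (leaves L) (occurs⇒∈ x R e)

∈⇒occurs : ∀ {n} x (T : Tree n) → x ∈ˡ leaves T → occurs x T ≡ true
∈⇒occurs x (leaf y) (here refl) = occurs-refl x
∈⇒occurs x (node L R) h with ∈-++⁻ (leaves L) h
... | inj₁ e = ∨-introˡ (occurs x R) (∈⇒occurs x L e)
... | inj₂ e = ∨-introʳ (occurs x L) (∈⇒occurs x R e)

some-leaf : ∀ {n} (T : Tree n) → Σ (Fin n) λ x → occurs x T ≡ true
some-leaf (leaf y)   = y , occurs-refl y
some-leaf (node L R) = let (x , h) = some-leaf L in x , ∨-introˡ (occurs x R) h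

data Distinct {n : ℕ} : Tree n → Set where
  leafᵈ : ∀ {x} → Distinct (leaf x)
  nodeᵈ : ∀ {L R} → (∀ x → occurs x L ≡ true → occurs x R ≡ false) →
          Distinct L → Distinct R → Distinct (node L R)

distinct-left : ∀ {n} {L R : Tree n} → Distinct (node L R) → ∀ x → occurs x L ≡ true → occurs x R ≡ false
distinct-left (nodeᵈ disj _ _) = disj

distinct-right : ∀ {n} {L R : Tree n} → Distinct (node L R) → ∀ x → occurs x R ≡ true → occurs x L ≡ false
distinct-right (nodeᵈ disj _ _) x xR = ¬-not (λ xL → true≢false (trans (sym xR) (disj x xL)))

distinct-swap : ∀ {n} {L R : Tree n} → Distinct (node L R) → Distinct (node R L)
distinct-swap d@(nodeᵈ _ dL dR) = nodeᵈ (distinct-right d) dR dL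

Unique-++⁻ : ∀ {A : Set} (xs ys : List A) → Unique (xs ++ ys) →
  Unique xs × Unique ys × (∀ {x} → x ∈ˡ xs → x ∈ˡ ys → ⊥)
Unique-++⁻ []       ys u          = [] , u , λ ()
Unique-++⁻ (x ∷ xs) ys (x∉ ∷ u) =
  let (uxs , uys , disj) = Unique-++⁻ xs ys u in
  (All.++⁻ˡ xs x∉ ∷ uxs) , uys ,
  λ { (here refl) y∈ → All.lookup x∉ (∈-++⁺ʳ xs y∈) refl ; (there x∈) y∈ → disj x∈ y∈ }

unique⇒distinct : ∀ {n} (T : Tree n) → Unique (leaves T) → Distinct T
unique⇒distinct (leaf x)   u = leafᵈ
unique⇒distinct (node L R) u =
  let (uL , uR , disj) = Unique-++⁻ (leaves L) (leaves R) u in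
  nodeᵈ (λ x xL → ¬-not (λ xR → disj (occurs⇒∈ x L xL) (occurs⇒∈ x R xR)))
        (unique⇒distinct L uL) (unique⇒distinct R uR)

valid-occurs : ∀ {n} (T : Tree n) → ValidTree T → ∀ x → occurs x T ≡ true
valid-occurs T p x = ∈⇒occurs x T (∈-resp-↭ (↭-sym p) (∈-allFin x))

valid-distinct : ∀ {n} (T : Tree n) → ValidTree T → Distinct T
valid-distinct {n} T p = unique⇒distinct T (Unique-resp-↭ (setoid (Fin n)) (↭⇒↭ₛ (↭-sym p)) (allFin⁺ n))

record _∼_ {n : ℕ} (T U : Tree n) : Set where
  constructor same
  field
    occurs≡   : ∀ x → occurs x T ≡ occurs x U
    displays≡ : ∀ t → displays t T ≡ displays t U
open _∼_

∼-sym : ∀ {n} {T U : Tree n} → T ∼ U → U ∼ T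
∼-sym (same occ disp) = same (λ x → sym (occ x)) (λ t → sym (disp t))

∼-trans : ∀ {n} {T U W : Tree n} → T ∼ U → U ∼ W → T ∼ W
∼-trans (same occ disp) (same occ′ disp′) = same (λ x → trans (occ x) (occ′ x)) (λ t → trans (disp t) (disp′ t))

≅⇒∼ : ∀ {n} {T U : Tree n} → T ≅ U → T ∼ U
≅⇒∼ p = same (λ x → occurs-≅ x p) (λ t → displays-≅ t p)

Inside : ∀ {n} → Tree n → Tree n → Set
Inside Z T = ∀ a b c → occurs a Z ≡ true → occurs b Z ≡ true → occurs c Z ≡ true →
  displays (a , b , c) T ≡ displays (a , b , c) Z

inside-left : ∀ {n} {L R : Tree n} → Distinct (node L R) → Inside L (node L R)
inside-left {L = L} {R} d a b c ha hb hc =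
  displays-nodeˡ a b c L R (distinct-left d a ha) (distinct-left d b hb) (distinct-left d c hc)

inside-right : ∀ {n} {L R : Tree n} → Distinct (node L R) → Inside R (node L R)
inside-right {L = L} {R} d a b c ha hb hc =
  displays-nodeʳ a b c L R (distinct-right d a ha) (distinct-right d b hb) (distinct-right d c hc)

-- Subtrees with the same leaves, sitting inside ∼-related trees, display the
-- same triples: triples leaving the subtree are decided by its leaf set alone.
subtrees-∼ : ∀ {n} {Z Z′ T T′ : Tree n} → (∀ x → occurs x Z ≡ occurs x Z′) → T ∼ T′ →
  Inside Z T → Inside Z′ T′ → Z ∼ Z′
subtrees-∼ {Z = Z} {Z′} occ (same _ disp) in₁ in₂ = same occ agree
  where
  agree : ∀ t → displays t Z ≡ displays t Z′
  agree (a , b , c) with occurs a Z in ea | occurs b Z in eb | occurs c Z in ec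
  ... | false | _ | _ = trans (displays-noᵃ a b c Z ea) (sym (displays-noᵃ a b c Z′ (trans (sym (occ a)) ea)))
  ... | true | false | _ = trans (displays-noᵇ a b c Z eb) (sym (displays-noᵇ a b c Z′ (trans (sym (occ b)) eb)))
  ... | true | true | false =
    trans (displays-root (a , b , c) Z (clusterHas-yes a b c Z ea eb ec))
          (sym (displays-root (a , b , c) Z′
                  (clusterHas-yes a b c Z′ (trans (sym (occ a)) ea) (trans (sym (occ b)) eb) (trans (sym (occ c)) ec))))
  ... | true | true | true =
    trans (sym (in₁ a b c ea eb ec))
          (trans (disp (a , b , c)) (in₂ a b c (trans (sym (occ a)) ea) (trans (sym (occ b)) eb) (trans (sym (occ c)) ec)))

-- If ∼-related distinct trees have children X₁ and Y₁ sharing a leaf a, then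
-- X₁ ⊆ Y₁: a leaf x ∈ X₁ ∖ Y₁ together with any c ∈ X₂ would give a triple
-- ax|c displayed by node X₁ X₂ but not by node Y₁ Y₂.
child-⊆ : ∀ {n} {X₁ X₂ Y₁ Y₂ : Tree n} → Distinct (node X₁ X₂) → Distinct (node Y₁ Y₂) →
  node X₁ X₂ ∼ node Y₁ Y₂ → ∀ a → occurs a X₁ ≡ true → occurs a Y₁ ≡ true →
  ∀ x → occurs x X₁ ≡ true → occurs x Y₁ ≡ true
child-⊆ {X₁ = X₁} {X₂} {Y₁} {Y₂} dX dY (same occ disp) a aX aY x xX with occurs x Y₁ in x∉Y₁
... | true  = refl
... | false = ⊥-elim (true≢false (trans (sym shownX) (trans (disp (a , x , c)) hiddenY)))
  where
  c  = proj₁ (some-leaf X₂)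
  cX = proj₂ (some-leaf X₂)
  shownX : displays (a , x , c) (node X₁ X₂) ≡ true
  shownX rewrite displays-root (a , x , c) X₁ (clusterHas-yes a x c X₁ aX xX (distinct-right dX c cX)) =
    ∨-zeroʳ (clusterHas (a , x , c) (node X₁ X₂))
  hiddenY : displays (a , x , c) (node Y₁ Y₂) ≡ false
  hiddenY rewrite clusterHas-noᶜ a x c (node Y₁ Y₂) (trans (sym (occ c)) (∨-introʳ (occurs c X₁) cX))
                | displays-noᵇ a x c Y₁ x∉Y₁ | displays-noᵃ a x c Y₂ (distinct-left dY a aY) = refl

children-∼ : ∀ {n} {X₁ X₂ Y₁ Y₂ : Tree n} → Distinct (node X₁ X₂) → Distinct (node Y₁ Y₂) →
  node X₁ X₂ ∼ node Y₁ Y₂ → ∀ a → occurs a X₁ ≡ true → occurs a Y₁ ≡ true → X₁ ∼ Y₁ × X₂ ∼ Y₂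
children-∼ {X₁ = X₁} {X₂} {Y₁} {Y₂} dX dY X∼Y@(same occ _) a aX aY =
  subtrees-∼ occ₁ X∼Y (inside-left dX) (inside-left dY) ,
  subtrees-∼ occ₂ X∼Y (inside-right dX) (inside-right dY)
  where
  occ₁ : ∀ x → occurs x X₁ ≡ occurs x Y₁
  occ₁ x = bool-ext (child-⊆ dX dY X∼Y a aX aY x) (child-⊆ dY dX (∼-sym X∼Y) a aY aX x)
  occ₂ : ∀ x → occurs x X₂ ≡ occurs x Y₂
  occ₂ x = bool-ext
    (λ xX → ∨-resolve (trans (sym (occ x)) (∨-introʳ (occurs x X₁) xX))
                      (trans (sym (occ₁ x)) (distinct-right dX x xX)))
    (λ xY → ∨-resolve (trans (occ x) (∨-introʳ (occurs x Y₁) xY))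
                      (trans (occ₁ x) (distinct-right dY x xY)))

leaf≁node : ∀ {n} x (U₁ U₂ : Tree n) → Distinct (node U₁ U₂) → ¬ (∀ y → occurs y (leaf x) ≡ occurs y (node U₁ U₂))
leaf≁node x U₁ U₂ d occ =
  let (y , yU) = some-leaf U₁ ; (z , zU) = some-leaf U₂
      y≡x = does-true (y ≟ᶠ x) (trans (occ y) (∨-introˡ (occurs y U₂) yU))
      z≡x = does-true (z ≟ᶠ x) (trans (occ z) (∨-introʳ (occurs z U₁) zU))
  in true≢false (trans (sym (subst (λ w → occurs w U₂ ≡ true) (trans z≡x (sym y≡x)) zU)) (distinct-left d y yU))

triples-determine : ∀ {n} (T U : Tree n) → Distinct T → Distinct U → T ∼ U → T ≅ U
triples-determine (leaf x) (leaf y) _ _ (same occ _)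
  with does-true (x ≟ᶠ y) (trans (sym (occ x)) (occurs-refl x))
... | refl = leaf≅ x
triples-determine (leaf x) (node U₁ U₂) _ dU (same occ _) = ⊥-elim (leaf≁node x U₁ U₂ dU occ)
triples-determine (node T₁ T₂) (leaf y) dT _ (same occ _) = ⊥-elim (leaf≁node y T₁ T₂ dT (λ z → sym (occ z)))
triples-determine (node T₁ T₂) (node U₁ U₂) dT@(nodeᵈ _ dT₁ dT₂) dU@(nodeᵈ _ dU₁ dU₂) T∼U
  with some-leaf T₁
... | a , aT with occurs a U₁ in aU₁
...   | true  = node≅ (triples-determine T₁ U₁ dT₁ dU₁ (proj₁ kids)) (triples-determine T₂ U₂ dT₂ dU₂ (proj₂ kids))
  where kids = children-∼ dT dU T∼U a aT aU₁
...   | false = swap≅ (triples-determine T₁ U₂ dT₁ dU₂ (proj₁ kids)) (triples-determine T₂ U₁ dT₂ dU₁ (proj₂ kids))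
  where
  aU₂ : occurs a U₂ ≡ true
  aU₂ = ∨-resolve (trans (sym (occurs≡ T∼U a)) (∨-introˡ (occurs a T₂) aT)) aU₁
  kids = children-∼ dT (distinct-swap dU) (∼-trans T∼U (≅⇒∼ (swap≅ (≅-refl U₁) (≅-refl U₂)))) a aT aU₂

sameTriples? : ∀ {n} (T U : Tree n) → Dec (∀ a b c → displays (a , b , c) T ≡ displays (a , b , c) U)
sameTriples? T U = all? λ a → all? λ b → all? λ c → displays (a , b , c) T ≟ᵇ displays (a , b , c) U

opaque
  _≈ᵗ_ : ∀ {n} → Tree n → Tree n → Bool
  T ≈ᵗ U = does (sameTriples? T U)

  ≈ᵗ-sound : ∀ {n} {T U : Tree n} → T ≈ᵗ U ≡ true → ∀ t → displays t T ≡ displays t U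
  ≈ᵗ-sound {T = T} {U} h (a , b , c) = does-true (sameTriples? T U) h a b c

  ≈ᵗ-complete : ∀ {n} {T U : Tree n} → (∀ t → displays t T ≡ displays t U) → T ≈ᵗ U ≡ true
  ≈ᵗ-complete {T = T} {U} h = dec-true (sameTriples? T U) (λ a b c → h (a , b , c))

  disagreement : ∀ {n} {T U : Tree n} → T ≈ᵗ U ≡ false → Σ (Triple n) λ t → displays t T ≢ displays t U
  disagreement {n} {T} {U} h =
    let (a , ¬a) = ¬∀⟶∃¬ n _ (λ a → all? λ b → all? λ c → agree? a b c) ¬all
        (b , ¬b) = ¬∀⟶∃¬ n _ (λ b → all? λ c → agree? a b c) ¬a
        (c , ¬c) = ¬∀⟶∃¬ n _ (λ c → agree? a b c) ¬b
    in (a , b , c) , ¬c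
    where
    agree? : ∀ a b c → Dec (displays (a , b , c) T ≡ displays (a , b , c) U)
    agree? a b c = displays (a , b , c) T ≟ᵇ displays (a , b , c) U
    ¬all : ¬ (∀ a b c → displays (a , b , c) T ≡ displays (a , b , c) U)
    ¬all p = true≢false (trans (sym (dec-true (sameTriples? T U) p)) h)

≈ᵗ-refl : ∀ {n} (T : Tree n) → T ≈ᵗ T ≡ true
≈ᵗ-refl T = ≈ᵗ-complete (λ t → refl)

≈ᵗ-sym : ∀ {n} (T U : Tree n) → T ≈ᵗ U ≡ true → U ≈ᵗ T ≡ true
≈ᵗ-sym T U h = ≈ᵗ-complete (λ t → sym (≈ᵗ-sound h t))

≈ᵗ-trans : ∀ {n} (T U W : Tree n) → T ≈ᵗ U ≡ true → U ≈ᵗ W ≡ true → T ≈ᵗ W ≡ true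
≈ᵗ-trans T U W h h′ = ≈ᵗ-complete (λ t → trans (≈ᵗ-sound h t) (≈ᵗ-sound h′ t))

module TripleMultiplicity {n : ℕ} = Multiplicity (_≈ᵗ_ {n}) ≈ᵗ-refl ≈ᵗ-sym ≈ᵗ-trans
open TripleMultiplicity

_≡ᵇ_ : Bool → Bool → Bool
true  ≡ᵇ b = b
false ≡ᵇ b = not b

≡ᵇ-refl : ∀ b → b ≡ᵇ b ≡ true
≡ᵇ-refl true  = refl
≡ᵇ-refl false = refl

Pattern : ℕ → Set
Pattern n = List (Triple n × Bool)

matchesᵛ : ∀ {n} {X : Set} → (Triple n → X → Bool) → Pattern n → X → Bool
matchesᵛ val []            x = true
matchesᵛ val ((t , b) ∷ p) x = (val t x ≡ᵇ b) ∧ matchesᵛ val p x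

matches : ∀ {n} → Pattern n → Tree n → Bool
matches = matchesᵛ displays

matchesᵛ-cong : ∀ {n} {X Y : Set} (val : Triple n → X → Bool) (val′ : Triple n → Y → Bool) {x y} →
  (∀ t → val t x ≡ val′ t y) → ∀ p → matchesᵛ val p x ≡ matchesᵛ val′ p y
matchesᵛ-cong val val′ h []            = refl
matchesᵛ-cong val val′ h ((t , b) ∷ p) = cong₂ (λ u w → (u ≡ᵇ b) ∧ w) (h t) (matchesᵛ-cong val val′ h p)

matches-≈ᵗ : ∀ {n} (p : Pattern n) {T U : Tree n} → T ≈ᵗ U ≡ true → matches p T ≡ matches p U
matches-≈ᵗ p h = matchesᵛ-cong displays displays (≈ᵗ-sound h) p

module Slicing {n r : ℕ} (f g : Fin r → Tree n) where

  N₁ N₂ : Pattern n → ℕ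
  N₁ p = count (matches p) f
  N₂ p = count (matches p) g

  Separating : ℕ → Set
  Separating b = Σ (Pattern n) λ p → length p ≤ b × N₁ p ≢ N₂ p

  others : Pattern n → Tree n → Tree n → Bool
  others q W u = matches q u ∧ not (W ≈ᵗ u)

  decompose : ∀ q W {s} (h : Fin s → Tree n) → matches q W ≡ true →
    mult W h + count (others q W) h ≡ count (matches q) h
  decompose q W h qW = trans (cong₂ _+_ (count-congˡ h inW) (count-congˡ h outW)) (count-split (W ≈ᵗ_) (matches q) h)
    where
    inW : ∀ x → (W ≈ᵗ x) ≡ ((W ≈ᵗ x) ∧ matches q x)
    inW x with W ≈ᵗ x in e
    ... | true  = trans (sym qW) (matches-≈ᵗ q e)
    ... | false = refl
    outW : ∀ x → others q W x ≡ (not (W ≈ᵗ x) ∧ matches q x)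
    outW x = ∧-comm (matches q x) (not (W ≈ᵗ x))

  Candidate : Pattern n → Tree n → Tree n → Set
  Candidate q W u = others q W u ≡ true × mult u f ≢ mult u g

  candidate? : ∀ q W u → Dec (Candidate q W u)
  candidate? q W u with others q W u ≟ᵇ true | mult u f ≟ mult u g
  ... | yes o | yes e = no (λ c → proj₂ c e)
  ... | yes o | no  e = yes (o , e)
  ... | no  o | _     = no (λ c → o (proj₁ c))

  no-candidate : ∀ q W → matches q W ≡ true → N₁ q ≡ N₂ q →
    ¬ (Σ (Fin r) λ i → Candidate q W (f i)) → ¬ (Σ (Fin r) λ i → Candidate q W (g i)) → mult W f ≡ mult W g
  no-candidate q W qW same-N nf ng = +-cancelʳ-≡ (count (others q W) f) _ _ (begin
    mult W f + count (others q W) f ≡⟨ decompose q W f qW ⟩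
    N₁ q                            ≡⟨ same-N ⟩
    N₂ q                            ≡⟨ sym (decompose q W g qW) ⟩
    mult W g + count (others q W) g ≡⟨ cong (mult W g +_) (sym same-others) ⟩
    mult W g + count (others q W) f ∎)
    where
    open ≡-Reasoning
    others-resp : ∀ x y → x ≈ᵗ y ≡ true → others q W x ≡ others q W y
    others-resp x y h = cong₂ _∧_ (matches-≈ᵗ q h) (cong not (≈ᵇ-congʳ W h))
    equal-mult : ∀ {s} (h : Fin s → Tree n) → ¬ (Σ (Fin s) λ i → Candidate q W (h i)) →
      ∀ i → others q W (h i) ≡ true → mult (h i) f ≡ mult (h i) g
    equal-mult h none i o with mult (h i) f ≟ mult (h i) g
    ... | yes e = e
    ... | no  e = ⊥-elim (none (i , o , e))
    same-others : count (others q W) f ≡ count (others q W) g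
    same-others = ≤-antisym
      (count-≤ (others q W) others-resp f g (λ i o → ≤-reflexive (equal-mult f nf i o)))
      (count-≤ (others q W) others-resp g f (λ i o → ≤-reflexive (sym (equal-mult g ng i o))))

  refine : Pattern n → Triple n → Bool → Pattern n
  refine q t b = (t , b) ∷ q

  refine-split : ∀ q t b → N₁ (refine q t b) + N₁ (refine q t (not b)) ≡ N₁ q
  refine-split q t b =
    trans (cong (N₁ (refine q t b) +_) (count-congˡ f (λ x → cong (_∧ matches q x) (≡ᵇ-not (displays t x) b))))
          (count-split (λ x → displays t x ≡ᵇ b) (matches q) f)
    where
    ≡ᵇ-not : ∀ x b → (x ≡ᵇ not b) ≡ not (x ≡ᵇ b)
    ≡ᵇ-not true  b = refl
    ≡ᵇ-not false b = refl

  -- U is a second candidate; a triple t on which W and U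
  -- disagree refines q into two patterns, matched by W and by U respectively,
  -- one of which is matched by fewer than 2^m trees of f.
  split : ∀ m q W → matches q W ≡ true → mult W f ≢ mult W g → N₁ q < 2 ^ suc m →
    (∀ q′ W′ → matches q′ W′ ≡ true → mult W′ f ≢ mult W′ g → N₁ q′ < 2 ^ m → Separating (length q′ + m)) →
    ∀ U → Candidate q W U → Separating (length q + suc m)
  split m q W qW W≢ small recurse U (oU , U≢) =
    [ (λ lt → lengthen {bW} (recurse (refine q t bW) W qW′ W≢ lt)) ,
      (λ lt → lengthen {not bW} (recurse (refine q t (not bW)) U qU′ U≢ lt)) ]′
    (halving m (subst (_< 2 ^ suc m) (sym (refine-split q t bW)) small))
    where
    W≉U : W ≈ᵗ U ≡ false
    W≉U = not-injective (∧-conicalʳ (matches q U) _ oU)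
    t  = proj₁ (disagreement W≉U)
    bW = displays t W
    tU : displays t U ≡ not bW
    tU = ¬-not (λ e → proj₂ (disagreement W≉U) (sym e))
    qW′ : matches (refine q t bW) W ≡ true
    qW′ = cong₂ _∧_ (≡ᵇ-refl bW) qW
    qU′ : matches (refine q t (not bW)) U ≡ true
    qU′ = cong₂ _∧_ (trans (cong (_≡ᵇ not bW) tU) (≡ᵇ-refl (not bW))) (∧-conicalˡ (matches q U) _ oU)
    lengthen : ∀ {b} → Separating (length (refine q t b) + m) → Separating (length q + suc m)
    lengthen = subst Separating (sym (+-suc (length q) m))

  slice : ∀ m q W → matches q W ≡ true → mult W f ≢ mult W g → N₁ q < 2 ^ m →
    Separating (length q + m)
  slice m q W qW W≢ small with N₁ q ≟ N₂ q
  ... | no N≢ = q , m≤m+n (length q) m , N≢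
  slice zero q W qW W≢ small | yes same-N =
    ⊥-elim (W≢ (trans (none f N₁q≡0) (sym (none g (trans (sym same-N) N₁q≡0)))))
    where
    N₁q≡0 : N₁ q ≡ 0
    N₁q≡0 = n≤0⇒n≡0 (≤-pred small)
    none : ∀ (h : Fin r → Tree n) → count (matches q) h ≡ 0 → mult W h ≡ 0
    none h zero-count = n≤0⇒n≡0 (subst (mult W h ≤_) (trans (decompose q W h qW) zero-count) (m≤m+n _ _))
  slice (suc m) q W qW W≢ small | yes same-N
    with any? (λ i → candidate? q W (f i)) | any? (λ i → candidate? q W (g i))
  ... | no nf        | no ng        = ⊥-elim (W≢ (no-candidate q W qW same-N nf ng))
  ... | yes (i , ci) | _            = split m q W qW W≢ small (slice m) (f i) ci
  ... | no _         | yes (i , ci) = split m q W qW W≢ small (slice m) (g i) ci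

keys : ∀ {n} → Pattern n → Subset n
keys []                    = ∅
keys (((a , b , c) , _) ∷ p) = ⁅ a ⁆ ∪ (⁅ b ⁆ ∪ (⁅ c ⁆ ∪ keys p))

keys-size : ∀ {n} (p : Pattern n) → ∣ keys p ∣ ≤ 3 * length p
keys-size {n} [] = ≤-reflexive (∣⊥∣≡0 n)
keys-size (((a , b , c) , _) ∷ p) = begin
  ∣ ⁅ a ⁆ ∪ (⁅ b ⁆ ∪ (⁅ c ⁆ ∪ keys p)) ∣             ≤⟨ ∣p∪q∣≤∣p∣+∣q∣ ⁅ a ⁆ _ ⟩
  ∣ ⁅ a ⁆ ∣ + ∣ ⁅ b ⁆ ∪ (⁅ c ⁆ ∪ keys p) ∣           ≤⟨ +-monoʳ-≤ ∣ ⁅ a ⁆ ∣ (∣p∪q∣≤∣p∣+∣q∣ ⁅ b ⁆ _) ⟩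
  ∣ ⁅ a ⁆ ∣ + (∣ ⁅ b ⁆ ∣ + ∣ ⁅ c ⁆ ∪ keys p ∣)       ≤⟨ +-monoʳ-≤ ∣ ⁅ a ⁆ ∣ (+-monoʳ-≤ ∣ ⁅ b ⁆ ∣ (∣p∪q∣≤∣p∣+∣q∣ ⁅ c ⁆ _)) ⟩
  ∣ ⁅ a ⁆ ∣ + (∣ ⁅ b ⁆ ∣ + (∣ ⁅ c ⁆ ∣ + ∣ keys p ∣)) ≡⟨ cong₂ _+_ (∣⁅x⁆∣≡1 a) (cong₂ _+_ (∣⁅x⁆∣≡1 b) (cong (_+ ∣ keys p ∣) (∣⁅x⁆∣≡1 c))) ⟩
  3 + ∣ keys p ∣                                    ≤⟨ +-monoʳ-≤ 3 (keys-size p) ⟩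
  3 + 3 * length p                                  ≡⟨ sym (*-suc 3 (length p)) ⟩
  3 * suc (length p)                                ∎
  where open ≤-Reasoning

matches-restrict : ∀ {n} (K : Subset n) (p : Pattern n) → (∀ y → y ∈ keys p → y ∈ K) →
  ∀ T → matchesᵛ displaysᴹ p (restrict K T) ≡ matches p T
matches-restrict K [] keys⊆K T = refl
matches-restrict K (((a , b , c) , x) ∷ p) keys⊆K T =
  cong₂ (λ u w → (u ≡ᵇ x) ∧ w)
    (displays-restrict K (keys⊆K a a∈) (keys⊆K b b∈) (keys⊆K c c∈) T)
    (matches-restrict K p (λ y y∈ → keys⊆K y (q⊆p∪q _ _ (q⊆p∪q _ _ (q⊆p∪q _ _ y∈)))) T)
  where
  a∈ = p⊆p∪q _ (x∈⁅x⁆ a)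
  b∈ = q⊆p∪q ⁅ a ⁆ _ (p⊆p∪q _ (x∈⁅x⁆ b))
  c∈ = q⊆p∪q ⁅ a ⁆ _ (q⊆p∪q ⁅ b ⁆ _ (p⊆p∪q _ (x∈⁅x⁆ c)))

matchesᴹ-≅ᴹ : ∀ {n} (p : Pattern n) {M M′ : Maybe (Tree n)} → M ≅ᴹ M′ →
  matchesᵛ displaysᴹ p M ≡ matchesᵛ displaysᴹ p M′
matchesᴹ-≅ᴹ p nothing≅  = refl
matchesᴹ-≅ᴹ p (just≅ e) = matchesᵛ-cong displaysᴹ displaysᴹ (λ t → displays-≅ t e) p

pattern-separates : ∀ {n r} (p : Pattern n) (S₁ S₂ : Vec (Tree n) r) →
  count (matches p) (lookup S₁) ≢ count (matches p) (lookup S₂) → Separates (keys p) S₁ S₂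
pattern-separates p S₁ S₂ N≢ (σ , h) =
  N≢ (trans (sym (restricted S₁))
     (trans (count-permute (matchesᵛ displaysᴹ p) (lookup (restrictList K S₁)) (lookup (restrictList K S₂)) σ
               (λ i → matchesᴹ-≅ᴹ p (h i)))
            (restricted S₂)))
  where
  K = keys p
  restricted : ∀ S → count (matchesᵛ displaysᴹ p) (lookup (restrictList K S)) ≡ count (matches p) (lookup S)
  restricted S = count-ext (matchesᵛ displaysᴹ p) (lookup (restrictList K S)) (matches p) (lookup S)
    (λ i → trans (cong (matchesᵛ displaysᴹ p) (lookup-map i (restrict K) S)) (matches-restrict K p (λ _ y∈ → y∈) (lookup S i)))

≈ᵗ⇒≅ : ∀ {n} {T U : Tree n} → ValidTree T → ValidTree U → T ≈ᵗ U ≡ true → T ≅ U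
≈ᵗ⇒≅ {T = T} {U} vT vU h = triples-determine T U (valid-distinct T vT) (valid-distinct U vU)
  (same (λ x → trans (valid-occurs T vT x) (sym (valid-occurs U vU x))) (≈ᵗ-sound h))

same-mult? : ∀ {n r} (S₁ S₂ : Vec (Tree n) r) (i : Fin r) →
  Dec (mult (lookup S₁ i) (lookup S₁) ≡ mult (lookup S₁ i) (lookup S₂))
same-mult? S₁ S₂ i = mult (lookup S₁ i) (lookup S₁) ≟ mult (lookup S₁ i) (lookup S₂)

unequal-multiplicity : ∀ {n r} (S₁ S₂ : Vec (Tree n) r) → ValidList S₁ → ValidList S₂ →
  ¬ MultisetEq _≅_ S₁ S₂ → Σ (Fin r) λ i → mult (lookup S₁ i) (lookup S₁) ≢ mult (lookup S₁ i) (lookup S₂)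
unequal-multiplicity {r = r} S₁ S₂ V₁ V₂ S₁≢S₂ with all? (same-mult? S₁ S₂)
... | no  some = ¬∀⟶∃¬ r _ (same-mult? S₁ S₂) some
... | yes all  = ⊥-elim (S₁≢S₂ (σ , λ i → ≈ᵗ⇒≅ (V₁ i) (V₂ (Inverse.to σ i)) (proj₂ m i)))
  where
  m = matching (lookup S₁) (lookup S₂) all
  σ = proj₁ m

upper-bound : ∀ r m → r < 2 ^ m → RD≤ r (3 * m)
upper-bound r m r<2^m n S₁ S₂ V₁ V₂ S₁≢S₂ =
  keys p , ≤-trans (keys-size p) (*-monoʳ-≤ 3 (proj₁ (proj₂ found))) , pattern-separates p S₁ S₂ (proj₂ (proj₂ found))
  where
  open Slicing (lookup S₁) (lookup S₂)
  W,≢ = unequal-multiplicity S₁ S₂ V₁ V₂ S₁≢S₂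
  found : Separating m
  found = slice m [] (lookup S₁ (proj₁ W,≢)) refl (proj₂ W,≢)
                (subst (_< 2 ^ m) (sym (count-const-true (lookup S₁))) r<2^m)
  p = proj₁ found

-- The lower-bound construction.  Level k has leaves 0, 1, 2 of its own and
-- the leaves of level k - 1 shifted by three.
shift : ∀ {m} → Fin m → Fin (3 + m)
shift x = suc (suc (suc x))

shiftTree : ∀ {m} → Tree m → Tree (3 + m)
shiftTree (leaf x)   = leaf (shift x)
shiftTree (node a b) = node (shiftTree a) (shiftTree b)

-- A = ((0,1),2) and B = ((0,2),1) differ only in the triple 01|2.
A B : ∀ {m} → Tree (3 + m)
A = node (node (leaf zero) (leaf (suc zero))) (leaf (suc (suc zero)))
B = node (node (leaf zero) (leaf (suc (suc zero)))) (leaf (suc zero))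

withA withB : ∀ {m} → Tree m → Tree (3 + m)
withA T = node A (shiftTree T)
withB T = node B (shiftTree T)

nLeaves : ℕ → ℕ
nLeaves zero    = 3
nLeaves (suc k) = 3 + nLeaves k

nTrees : ℕ → ℕ
nTrees zero    = 1
nTrees (suc k) = nTrees k + nTrees k

PQ : (k : ℕ) → Vec (Tree (nLeaves k)) (nTrees k) × Vec (Tree (nLeaves k)) (nTrees k)
PQ zero    = (A ∷ []) , (B ∷ [])
PQ (suc k) = (map withA (proj₁ (PQ k)) ++ᵛ map withB (proj₂ (PQ k))) ,
             (map withA (proj₂ (PQ k)) ++ᵛ map withB (proj₁ (PQ k)))

P Q : (k : ℕ) → Vec (Tree (nLeaves k)) (nTrees k)
P k = proj₁ (PQ k)
Q k = proj₂ (PQ k)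

-- The tree used for padding: A at every level.
spine : (k : ℕ) → Tree (nLeaves k)
spine zero    = A
spine (suc k) = withA (spine k)

leaves-count : ∀ k → nLeaves k ≡ 3 * (k + 1)
leaves-count zero    = refl
leaves-count (suc k) = trans (cong (3 +_) (leaves-count k)) (sym (*-suc 3 (k + 1)))

length-count : ∀ k → nTrees k ≡ 2 ^ k
length-count zero    = refl
length-count (suc k) = trans (cong₂ _+_ (length-count k) (length-count k)) (cong (2 ^ k +_) (sym (+-identityʳ (2 ^ k))))

leaves-shift : ∀ {m} (T : Tree m) → leaves (shiftTree T) ≡ List.map shift (leaves T)
leaves-shift (leaf x)   = refl
leaves-shift (node a b) = trans (cong₂ _++_ (leaves-shift a) (leaves-shift b)) (sym (List.map-++ shift (leaves a) (leaves b)))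

allFin-shift : ∀ m → allFin (3 + m) ≡ zero ∷ suc zero ∷ suc (suc zero) ∷ List.map shift (allFin m)
allFin-shift m = cong (λ xs → zero ∷ suc zero ∷ suc (suc zero) ∷ xs) (sym (List.map-tabulate (λ x → x) shift))

shift-valid : ∀ {m} (T : Tree m) → ValidTree T → leaves (shiftTree T) ↭ List.map shift (allFin m)
shift-valid T vT = subst (_↭ _) (sym (leaves-shift T)) (↭-map⁺ shift vT)

withA-valid : ∀ {m} (T : Tree m) → ValidTree T → ValidTree (withA T)
withA-valid {m} T vT = subst (leaves (withA T) ↭_) (sym (allFin-shift m)) (prep _ (prep _ (prep _ (shift-valid T vT))))

withB-valid : ∀ {m} (T : Tree m) → ValidTree T → ValidTree (withB T)
withB-valid {m} T vT = subst (leaves (withB T) ↭_) (sym (allFin-shift m)) (prep _ (swap _ _ (shift-valid T vT)))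

PQ-valid : ∀ k → Allᵛ ValidTree (P k) × Allᵛ ValidTree (Q k)
PQ-valid zero    = (↭-refl ∷ []) , (prep _ (swap _ _ ↭-refl) ∷ [])
PQ-valid (suc k) = let (vP , vQ) = PQ-valid k in
  ++ᵛ⁺ (gmap (λ {T} → withA-valid T) vP) (gmap (λ {T} → withB-valid T) vQ) ,
  ++ᵛ⁺ (gmap (λ {T} → withA-valid T) vQ) (gmap (λ {T} → withB-valid T) vP)

spine-valid : ∀ k → ValidTree (spine k)
spine-valid zero    = ↭-refl
spine-valid (suc k) = withA-valid (spine k) (spine-valid k)

shiftᴹ : ∀ {m} → Maybe (Tree m) → Maybe (Tree (3 + m))
shiftᴹ nothing  = nothing
shiftᴹ (just T) = just (shiftTree T)

joinᴹ-shift : ∀ {m} (x y : Maybe (Tree m)) → joinᴹ (shiftᴹ x) (shiftᴹ y) ≡ shiftᴹ (joinᴹ x y)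
joinᴹ-shift (just _) (just _) = refl
joinᴹ-shift (just _) nothing  = refl
joinᴹ-shift nothing  (just _) = refl
joinᴹ-shift nothing  nothing  = refl

restrict-shift : ∀ {m} b₀ b₁ b₂ (K : Subset m) T →
  restrict (b₀ ∷ b₁ ∷ b₂ ∷ K) (shiftTree T) ≡ shiftᴹ (restrict K T)
restrict-shift b₀ b₁ b₂ K (leaf y) with y ∈? K
... | yes _ = refl
... | no  _ = refl
restrict-shift b₀ b₁ b₂ K (node a b) = begin
  restrict _ (node (shiftTree a) (shiftTree b))                      ≡⟨ restrict-node _ (shiftTree a) (shiftTree b) ⟩
  joinᴹ (restrict _ (shiftTree a)) (restrict _ (shiftTree b))        ≡⟨ cong₂ joinᴹ (restrict-shift b₀ b₁ b₂ K a) (restrict-shift b₀ b₁ b₂ K b) ⟩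
  joinᴹ (shiftᴹ (restrict K a)) (shiftᴹ (restrict K b))              ≡⟨ joinᴹ-shift _ _ ⟩
  shiftᴹ (joinᴹ (restrict K a) (restrict K b))                       ≡⟨ cong shiftᴹ (sym (restrict-node K a b)) ⟩
  shiftᴹ (restrict K (node a b))                                     ∎
  where open ≡-Reasoning

≅ᴹ-refl : ∀ {m} (M : Maybe (Tree m)) → M ≅ᴹ M
≅ᴹ-refl nothing  = nothing≅
≅ᴹ-refl (just T) = just≅ (≅-refl T)

≅ᴹ-sym : ∀ {m} {M M′ : Maybe (Tree m)} → M ≅ᴹ M′ → M′ ≅ᴹ M
≅ᴹ-sym nothing≅  = nothing≅
≅ᴹ-sym (just≅ e) = just≅ (≅-sym e)

shiftTree-≅ : ∀ {m} {T U : Tree m} → T ≅ U → shiftTree T ≅ shiftTree U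
shiftTree-≅ (leaf≅ x)   = leaf≅ (shift x)
shiftTree-≅ (node≅ p q) = node≅ (shiftTree-≅ p) (shiftTree-≅ q)
shiftTree-≅ (swap≅ p q) = swap≅ (shiftTree-≅ p) (shiftTree-≅ q)

shiftᴹ-≅ᴹ : ∀ {m} {M M′ : Maybe (Tree m)} → M ≅ᴹ M′ → shiftᴹ M ≅ᴹ shiftᴹ M′
shiftᴹ-≅ᴹ nothing≅  = nothing≅
shiftᴹ-≅ᴹ (just≅ e) = just≅ (shiftTree-≅ e)

joinᴹ-≅ᴹ : ∀ {m} {M₁ M₁′ M₂ M₂′ : Maybe (Tree m)} → M₁ ≅ᴹ M₁′ → M₂ ≅ᴹ M₂′ → joinᴹ M₁ M₂ ≅ᴹ joinᴹ M₁′ M₂′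
joinᴹ-≅ᴹ nothing≅  nothing≅  = nothing≅
joinᴹ-≅ᴹ nothing≅  (just≅ e) = just≅ e
joinᴹ-≅ᴹ (just≅ e) nothing≅  = just≅ e
joinᴹ-≅ᴹ (just≅ e) (just≅ f) = just≅ (node≅ e f)

A≅B-without : ∀ {m} b₀ b₁ b₂ (K : Subset m) → b₀ ≡ false ⊎ b₁ ≡ false ⊎ b₂ ≡ false →
  restrict (b₀ ∷ b₁ ∷ b₂ ∷ K) A ≅ᴹ restrict (b₀ ∷ b₁ ∷ b₂ ∷ K) B
A≅B-without true  true  true  K (inj₁ ())
A≅B-without true  true  true  K (inj₂ (inj₁ ()))
A≅B-without true  true  true  K (inj₂ (inj₂ ()))
A≅B-without false true  true  K _ = just≅ (swap≅ (leaf≅ _) (leaf≅ _))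
A≅B-without true  false true  K _ = ≅ᴹ-refl _
A≅B-without true  true  false K _ = ≅ᴹ-refl _
A≅B-without false false true  K _ = ≅ᴹ-refl _
A≅B-without false true  false K _ = ≅ᴹ-refl _
A≅B-without true  false false K _ = ≅ᴹ-refl _
A≅B-without false false false K _ = ≅ᴹ-refl _

missing-leaf : ∀ {m} b₀ b₁ b₂ (K : Subset m) x → x ∉ (b₀ ∷ b₁ ∷ b₂ ∷ K) →
  (b₀ ≡ false ⊎ b₁ ≡ false ⊎ b₂ ≡ false) ⊎ Σ (Fin m) λ y → y ∉ K
missing-leaf true  b₁ b₂ K zero x∉ = ⊥-elim (x∉ here)
missing-leaf false b₁ b₂ K zero x∉ = inj₁ (inj₁ refl)
missing-leaf b₀ true  b₂ K (suc zero) x∉ = ⊥-elim (x∉ (there here))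
missing-leaf b₀ false b₂ K (suc zero) x∉ = inj₁ (inj₂ (inj₁ refl))
missing-leaf b₀ b₁ true  K (suc (suc zero)) x∉ = ⊥-elim (x∉ (there (there here)))
missing-leaf b₀ b₁ false K (suc (suc zero)) x∉ = inj₁ (inj₂ (inj₂ refl))
missing-leaf b₀ b₁ b₂ K (suc (suc (suc y))) x∉ = inj₂ (y , λ y∈ → x∉ (there (there (there y∈))))

attachᴹ : ∀ {m} → Subset (3 + m) → Tree (3 + m) → Maybe (Tree m) → Maybe (Tree (3 + m))
attachᴹ K X M = joinᴹ (restrict K X) (shiftᴹ M)

restrict-attach : ∀ {m l} (X : Tree (3 + m)) b₀ b₁ b₂ (K : Subset m) (V : Vec (Tree m) l) →
  restrictList (b₀ ∷ b₁ ∷ b₂ ∷ K) (map (λ T → node X (shiftTree T)) V) ≡ map (attachᴹ (b₀ ∷ b₁ ∷ b₂ ∷ K) X) (restrictList K V)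
restrict-attach X b₀ b₁ b₂ K []      = refl
restrict-attach X b₀ b₁ b₂ K (T ∷ V) =
  cong₂ _∷_ (trans (restrict-node _ X (shiftTree T)) (cong (joinᴹ _) (restrict-shift b₀ b₁ b₂ K T)))
            (restrict-attach X b₀ b₁ b₂ K V)

attach-≅ᴹ : ∀ {m} (K : Subset (3 + m)) X {M M′ : Maybe (Tree m)} → M ≅ᴹ M′ → attachᴹ K X M ≅ᴹ attachᴹ K X M′
attach-≅ᴹ K X e = joinᴹ-≅ᴹ (≅ᴹ-refl _) (shiftᴹ-≅ᴹ e)

-- If the
-- missing leaf is new, A and B coincide and the two halves of P (k+1) and
-- Q (k+1) match crosswise; otherwise P k|K and Q k|K agree by induction.
PQ-agree-without : ∀ k (K : Subset (nLeaves k)) x → x ∉ K →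
  MultisetEq _≅ᴹ_ (restrictList K (P k)) (restrictList K (Q k))
PQ-agree-without zero (b₀ ∷ b₁ ∷ b₂ ∷ []) x x∉ with missing-leaf b₀ b₁ b₂ [] x x∉
... | inj₁ new = Perm.id , λ { zero → A≅B-without b₀ b₁ b₂ [] new }
... | inj₂ (() , _)
PQ-agree-without (suc k) K₃@(b₀ ∷ b₁ ∷ b₂ ∷ K) x x∉ =
  subst₂ (MultisetEq _≅ᴹ_) (sym (restricted (P k) (Q k))) (sym (restricted (Q k) (P k))) agree
  where
  attA = attachᴹ K₃ A
  attB = attachᴹ K₃ B
  Pr = restrictList K (P k)
  Qr = restrictList K (Q k)
  restricted : ∀ (V W : Vec (Tree (nLeaves k)) (nTrees k)) → restrictList K₃ (map withA V ++ᵛ map withB W) ≡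
                        map attA (restrictList K V) ++ᵛ map attB (restrictList K W)
  restricted V W = trans (map-++ (restrict K₃) (map withA V) (map withB W))
                         (cong₂ _++ᵛ_ (restrict-attach A b₀ b₁ b₂ K V) (restrict-attach B b₀ b₁ b₂ K W))
  agree : MultisetEq _≅ᴹ_ (map attA Pr ++ᵛ map attB Qr) (map attA Qr ++ᵛ map attB Pr)
  agree with missing-leaf b₀ b₁ b₂ K x x∉
  ... | inj₁ new = multiset-++-swap _≅ᴹ_ (map attA Pr) (map attB Pr) (map attB Qr) (map attA Qr)
        (λ i → subst₂ _≅ᴹ_ (sym (lookup-map i attA Pr)) (sym (lookup-map i attB Pr)) (A≅B (lookup Pr i)))
        (λ i → subst₂ _≅ᴹ_ (sym (lookup-map i attB Qr)) (sym (lookup-map i attA Qr)) (≅ᴹ-sym (A≅B (lookup Qr i))))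
    where
    A≅B : ∀ M → attA M ≅ᴹ attB M
    A≅B M = joinᴹ-≅ᴹ (A≅B-without b₀ b₁ b₂ K new) (≅ᴹ-refl _)
  ... | inj₂ (y , y∉) = multiset-++ _≅ᴹ_ (map attA Pr) (map attA Qr) (map attB Qr) (map attB Pr)
        (multiset-map _≅ᴹ_ _≅ᴹ_ attA (attach-≅ᴹ K₃ A) Pr Qr IH)
        (multiset-map _≅ᴹ_ _≅ᴹ_ attB (attach-≅ᴹ K₃ B) Qr Pr (multiset-sym _≅ᴹ_ ≅ᴹ-sym Pr Qr IH))
    where IH = PQ-agree-without k K y y∉

t₀₁₂ : ∀ {m} → Triple (3 + m)
t₀₁₂ = zero , suc zero , suc (suc zero)

shiftᵗ : ∀ {m} → Triple m → Triple (3 + m)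
shiftᵗ (a , b , c) = shift a , shift b , shift c

everyLevel : (k : ℕ) → (Triple (nLeaves k) → Bool) → Bool
everyLevel zero    val = val t₀₁₂
everyLevel (suc k) val = val t₀₁₂ ∧ everyLevel k (val ∘ shiftᵗ)

everyLevel-cong : ∀ k {val val′ : Triple (nLeaves k) → Bool} → (∀ t → val t ≡ val′ t) →
  everyLevel k val ≡ everyLevel k val′
everyLevel-cong zero    h = h t₀₁₂
everyLevel-cong (suc k) h = cong₂ _∧_ (h t₀₁₂) (everyLevel-cong k (h ∘ shiftᵗ))

ψ : (k : ℕ) → Tree (nLeaves k) → Bool
ψ k T = everyLevel k (λ t → displays t T)

ψ-≅ : ∀ k {T U : Tree (nLeaves k)} → T ≅ U → ψ k T ≡ ψ k U
ψ-≅ k e = everyLevel-cong k (λ t → displays-≅ t e)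

occurs-shift : ∀ {m} (a : Fin m) T → occurs (shift a) (shiftTree T) ≡ occurs a T
occurs-shift a (leaf y)   = refl
occurs-shift a (node L R) = cong₂ _∨_ (occurs-shift a L) (occurs-shift a R)

occurs-new-shift : ∀ {m} (T : Tree m) → occurs zero (shiftTree T) ≡ false
occurs-new-shift (leaf x)   = refl
occurs-new-shift (node a b) = cong₂ _∨_ (occurs-new-shift a) (occurs-new-shift b)

displays-shift : ∀ {m} (t : Triple m) T → displays (shiftᵗ t) (shiftTree T) ≡ displays t T
displays-shift t@(a , b , c) T = go T
  where
  cluster : ∀ T → clusterHas (shiftᵗ t) (shiftTree T) ≡ clusterHas t T
  cluster T rewrite occurs-shift a T | occurs-shift b T | occurs-shift c T = refl
  go : ∀ T → displays (shiftᵗ t) (shiftTree T) ≡ displays t T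
  go (leaf y)   = cluster (leaf y)
  go (node L R) = cong₂ _∨_ (cluster (node L R)) (cong₂ _∨_ (go L) (go R))

ψ-withA : ∀ k T → ψ (suc k) (withA T) ≡ ψ k T
ψ-withA k T rewrite ∨-zeroʳ (clusterHas t₀₁₂ (withA T)) =
  everyLevel-cong k (λ t@(a , b , c) →
    trans (displays-nodeʳ (shift a) (shift b) (shift c) A (shiftTree T) refl refl refl) (displays-shift t T))

ψ-withB : ∀ k T → ψ (suc k) (withB T) ≡ false
ψ-withB k T rewrite displays-noᵃ zero (suc zero) (suc (suc zero)) (shiftTree T) (occurs-new-shift T) = refl

count-++ᵛ : ∀ {X : Set} {a b} (P : X → Bool) (xs : Vec X a) (ys : Vec X b) →
  count P (lookup (xs ++ᵛ ys)) ≡ count P (lookup xs) + count P (lookup ys)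
count-++ᵛ P []       ys = refl
count-++ᵛ P (x ∷ xs) ys = trans (cong (𝟙 (P x) +_) (count-++ᵛ P xs ys)) (sym (+-assoc (𝟙 (P x)) _ _))

count-map : ∀ {X Y : Set} {a} (P : Y → Bool) (h : X → Y) (xs : Vec X a) →
  count P (lookup (map h xs)) ≡ count (P ∘ h) (lookup xs)
count-map P h xs = count-ext P (lookup (map h xs)) (P ∘ h) (lookup xs) (λ i → cong P (lookup-map i h xs))

count-ψ-step : ∀ k (V W : Vec (Tree (nLeaves k)) (nTrees k)) →
  count (ψ (suc k)) (lookup (map withA V ++ᵛ map withB W)) ≡ count (ψ k) (lookup V)
count-ψ-step k V W = begin
  count (ψ (suc k)) (lookup (map withA V ++ᵛ map withB W))                    ≡⟨ count-++ᵛ (ψ (suc k)) (map withA V) (map withB W) ⟩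
  count (ψ (suc k)) (lookup (map withA V)) + count (ψ (suc k)) (lookup (map withB W))
      ≡⟨ cong₂ _+_ (trans (count-map (ψ (suc k)) withA V) (count-congˡ (lookup V) (ψ-withA k)))
                   (trans (count-map (ψ (suc k)) withB W) (count-const-false _ (lookup W) (ψ-withB k))) ⟩
  count (ψ k) (lookup V) + 0                                                  ≡⟨ +-identityʳ _ ⟩
  count (ψ k) (lookup V)                                                      ∎
  where open ≡-Reasoning

count-ψ : ∀ k → count (ψ k) (lookup (P k)) ≡ 1 × count (ψ k) (lookup (Q k)) ≡ 0
count-ψ zero    = refl , refl
count-ψ (suc k) = trans (count-ψ-step k (P k) (Q k)) (proj₁ (count-ψ k)) ,
                  trans (count-ψ-step k (Q k) (P k)) (proj₂ (count-ψ k))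

-- Lower bound: P k and Q k padded with e copies of spine k are distinct
-- lists of length 2^k + e (ψ counts 1 + x versus x) that agree on every K
-- with fewer than 3 (k + 1) leaves, since such K misses a leaf.
lower-bound : ∀ k e → RD≥ (nTrees k + e) (3 * (k + 1))
lower-bound k e = nLeaves k , S₁ , S₂ , valid (proj₁ (PQ-valid k)) , valid (proj₂ (PQ-valid k)) , distinct , agree
  where
  pad = replicate e (spine k)
  S₁ = P k ++ᵛ pad
  S₂ = Q k ++ᵛ pad
  valid : ∀ {V : Vec (Tree (nLeaves k)) (nTrees k)} → Allᵛ ValidTree V → ValidList (V ++ᵛ pad)
  valid vV = lookup⁺ (++ᵛ⁺ vV (lookup⁻ (λ i → subst ValidTree (sym (lookup-replicate i (spine k))) (spine-valid k))))
  x = count (ψ k) (lookup pad)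
  distinct : ¬ MultisetEq _≅_ S₁ S₂
  distinct (σ , h) = m≢1+m+n x {0} (begin
    x                             ≡⟨ sym (cong (_+ x) (proj₂ (count-ψ k))) ⟩
    count (ψ k) (lookup (Q k)) + x ≡⟨ sym (count-++ᵛ (ψ k) (Q k) pad) ⟩
    count (ψ k) (lookup S₂)        ≡⟨ sym (count-permute (ψ k) (lookup S₁) (lookup S₂) σ (λ i → ψ-≅ k (h i))) ⟩
    count (ψ k) (lookup S₁)        ≡⟨ count-++ᵛ (ψ k) (P k) pad ⟩
    count (ψ k) (lookup (P k)) + x ≡⟨ cong (_+ x) (proj₁ (count-ψ k)) ⟩
    suc x                          ≡⟨ cong suc (sym (+-identityʳ x)) ⟩
    suc (x + 0)                    ∎)
    where open ≡-Reasoning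
  agree : ∀ K → ∣ K ∣ < 3 * (k + 1) → MultisetEq _≅ᴹ_ (restrictList K S₁) (restrictList K S₂)
  agree K small =
    let (y , y∉) = missing-element K (subst (∣ K ∣ <_) (sym (leaves-count k)) small) in
    subst₂ (MultisetEq _≅ᴹ_) (sym (map-++ (restrict K) (P k) pad)) (sym (map-++ (restrict K) (Q k) pad))
      (multiset-++ _≅ᴹ_ (restrictList K (P k)) (restrictList K (Q k)) (restrictList K pad) (restrictList K pad)
        (PQ-agree-without k K y y∉)
        (multiset-pointwise _≅ᴹ_ (restrictList K pad) (restrictList K pad) (λ i → ≅ᴹ-refl _)))

-- RD(r) = 3 (⌊log₂ r⌋ + 1): with k = ⌊log₂ r⌋ we have 2^k ≤ r < 2^(k+1);
-- the upper bound uses r < 2^(k+1), the lower bound pads 2^k trees to r.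
theorem4 : ∀ (r : ℕ) → 1 ≤ r → RDis r (3 * (⌊log₂ r ⌋ + 1))
theorem4 r 1≤r =
  upper-bound r (k + 1) (subst (λ j → r < 2 ^ j) (+-comm 1 k) (proj₂ bounds)) ,
  subst (λ s → RD≥ s (3 * (k + 1))) (m+[n∸m]≡n 2^k≤r) (lower-bound k (r ∸ nTrees k))
  where
  k = ⌊log₂ r ⌋
  bounds = log₂-bounds r 1≤r
  2^k≤r : nTrees k ≤ r
  2^k≤r = subst (_≤ r) (sym (length-count k)) (proj₁ bounds)
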